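{- The only non-trivial structurally complete extensions of $\mathsf{BD}$ are $\mathsf{K}$ and $\mathsf{CL}$.
   Context: Formulas are built from a countably infinite set of variables using $\wedge,\vee$, ${\sim}$, $\top,\bot$. A logic is a set of rules $\Gamma\vdash\varphi$ closed under reflexivity, monotonicity, cut and substitution; an extension of $L$ is a logic containing $L$; the trivial logic contains all rules. A rule $\Gamma\vdash\varphi$ is admissible in $L$ if for every substitution $\sigma$, if $\emptyset\vdash_L\sigma(\gamma)$ for all $\gamma\in\Gamma$ then $\emptyset\vdash_L\sigma(\varphi)$; $L$ is structurally complete if every rule admissible in $L$ belongs to $L$. For a matrix, a rule is valid if every valuation sending the premises into the designated set sends the conclusion there. Let $\mathbf{DM}_4$ be the De Morgan algebra on $\{\bot,n,b,\top\}$ with $\bot<n,b<\top$ ($n,b$ incomparable), ${\sim}$ swapping $\top,\bot$ and fixing $n,b$. $\mathsf{BD}$, $\mathsf{K}$, $\mathsf{CL}$ are the sets of rules valid in $\langle\mathbf{DM}_4,\{b,\top\}\rangle$, $\langle\{\bot,n,\top\},\{\top\}\rangle$, $\langle\{\bot,\top\},\{\top\}\rangle$ respectively. -}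

module Defs where

open import Data.Nat using (ℕ)
open import Data.Product using (Σ; _×_; _,_)
open import Data.Sum using (_⊎_)
open import Relation.Nullary using (¬_)
open import Relation.Binary.PropositionalEquality using (_≡_)
open import Data.Empty using (⊥)
open import Data.Unit using (⊤)
open import Level using (Level; Setω)
open import Axiom.ExcludedMiddle using (ExcludedMiddle)

infixr 6 _∧_
infixr 5 _∨_

data Fm : Set where
  var : ℕ → Fm
  _∧_ : Fm → Fm → Fm
  _∨_ : Fm → Fm → Fm
  ∼_  : Fm → Fm
  top : Fm
  bot : Fm

Subst : Set
Subst = ℕ → Fm

_[_] : Fm → Subst → Fm
var x   [ σ ] = σ x
(φ ∧ ψ) [ σ ] = (φ [ σ ]) ∧ (ψ [ σ ])
(φ ∨ ψ) [ σ ] = (φ [ σ ]) ∨ (ψ [ σ ])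
(∼ φ)   [ σ ] = ∼ (φ [ σ ])
top     [ σ ] = top
bot     [ σ ] = bot

FmSet : Set₁
FmSet = Fm → Set

∅ : FmSet
∅ _ = ⊥

_⊆_ : FmSet → FmSet → Set
Γ ⊆ Δ = ∀ φ → Γ φ → Δ φ

_∪_ : FmSet → FmSet → FmSet
(Γ ∪ Δ) φ = Γ φ ⊎ Δ φ

img : Subst → FmSet → FmSet
img σ Γ ψ = Σ Fm (λ χ → Γ χ × (χ [ σ ]) ≡ ψ)

RuleSet : Set₁
RuleSet = FmSet → Fm → Set

record IsLogic (L : RuleSet) : Set₁ where
  field
    reflexivity  : ∀ Γ φ → Γ φ → L Γ φ
    monotonicity : ∀ Γ Δ φ → Γ ⊆ Δ → L Γ φ → L Δ φ
    cut          : ∀ Γ Δ φ → (∀ ψ → Δ ψ → L Γ ψ) → L (Γ ∪ Δ) φ → L Γ φ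
    substitution : ∀ Γ φ (σ : Subst) → L Γ φ → L (img σ Γ) (φ [ σ ])

_Extends_ : RuleSet → RuleSet → Set₁
L' Extends L = IsLogic L' × (∀ Γ φ → L Γ φ → L' Γ φ)

_≐_ : RuleSet → RuleSet → Set₁
L ≐ M = (∀ Γ φ → L Γ φ → M Γ φ) × (∀ Γ φ → M Γ φ → L Γ φ)

Trivial : RuleSet → Set₁
Trivial L = ∀ Γ φ → L Γ φ

NonTrivial : RuleSet → Set₁
NonTrivial L = ¬ Trivial L

Admissible : RuleSet → FmSet → Fm → Set
Admissible L Γ φ =
  ∀ (σ : Subst) → (∀ γ → Γ γ → L ∅ (γ [ σ ])) → L ∅ (φ [ σ ])

StructurallyComplete : RuleSet → Set₁
StructurallyComplete L = ∀ Γ φ → Admissible L Γ φ → L Γ φ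

record Matrix : Set₁ where
  field
    A      : Set
    _∧ᴬ_   : A → A → A
    _∨ᴬ_   : A → A → A
    ∼ᴬ_    : A → A
    ⊤ᴬ     : A
    ⊥ᴬ     : A
    D      : A → Set

module _ (M : Matrix) where
  open Matrix M
  ⟦_⟧ : Fm → (ℕ → A) → A
  ⟦ var x ⟧ v = v x
  ⟦ φ ∧ ψ ⟧ v = ⟦ φ ⟧ v ∧ᴬ ⟦ ψ ⟧ v
  ⟦ φ ∨ ψ ⟧ v = ⟦ φ ⟧ v ∨ᴬ ⟦ ψ ⟧ v
  ⟦ ∼ φ ⟧ v   = ∼ᴬ ⟦ φ ⟧ v
  ⟦ top ⟧ v   = ⊤ᴬ
  ⟦ bot ⟧ v   = ⊥ᴬ

Valid : Matrix → RuleSet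
Valid M Γ φ = ∀ (v : ℕ → Matrix.A M) →
  (∀ γ → Γ γ → Matrix.D M (⟦_⟧ M γ v)) → Matrix.D M (⟦_⟧ M φ v)

-- DM4 on {⊥, n, b, ⊤} with ⊥ < n, b < ⊤, n and b incomparable

data DM4 : Set where
  ⊥₄ n₄ b₄ ⊤₄ : DM4

_∧₄_ : DM4 → DM4 → DM4
⊥₄ ∧₄ y  = ⊥₄
⊤₄ ∧₄ y  = y
n₄ ∧₄ ⊥₄ = ⊥₄
n₄ ∧₄ n₄ = n₄
n₄ ∧₄ b₄ = ⊥₄
n₄ ∧₄ ⊤₄ = n₄
b₄ ∧₄ ⊥₄ = ⊥₄
b₄ ∧₄ n₄ = ⊥₄
b₄ ∧₄ b₄ = b₄
b₄ ∧₄ ⊤₄ = b₄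

_∨₄_ : DM4 → DM4 → DM4
⊥₄ ∨₄ y  = y
⊤₄ ∨₄ y  = ⊤₄
n₄ ∨₄ ⊥₄ = n₄
n₄ ∨₄ n₄ = n₄
n₄ ∨₄ b₄ = ⊤₄
n₄ ∨₄ ⊤₄ = ⊤₄
b₄ ∨₄ ⊥₄ = b₄
b₄ ∨₄ n₄ = ⊤₄
b₄ ∨₄ b₄ = b₄
b₄ ∨₄ ⊤₄ = ⊤₄

∼₄ : DM4 → DM4
∼₄ ⊥₄ = ⊤₄
∼₄ n₄ = n₄
∼₄ b₄ = b₄
∼₄ ⊤₄ = ⊥₄

D₄ : DM4 → Set
D₄ ⊥₄ = ⊥
D₄ n₄ = ⊥
D₄ b₄ = ⊤
D₄ ⊤₄ = ⊤

BD-matrix : Matrix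
BD-matrix = record { A = DM4 ; _∧ᴬ_ = _∧₄_ ; _∨ᴬ_ = _∨₄_ ; ∼ᴬ_ = ∼₄
                   ; ⊤ᴬ = ⊤₄ ; ⊥ᴬ = ⊥₄ ; D = D₄ }

-- The subalgebra {⊥, n, ⊤} of DM4 (operations are the restrictions)
data K3 : Set where
  ⊥₃ n₃ ⊤₃ : K3

_∧₃_ : K3 → K3 → K3
⊥₃ ∧₃ y  = ⊥₃
⊤₃ ∧₃ y  = y
n₃ ∧₃ ⊥₃ = ⊥₃
n₃ ∧₃ n₃ = n₃
n₃ ∧₃ ⊤₃ = n₃

_∨₃_ : K3 → K3 → K3
⊥₃ ∨₃ y  = y
⊤₃ ∨₃ y  = ⊤₃
n₃ ∨₃ ⊥₃ = n₃
n₃ ∨₃ n₃ = n₃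
n₃ ∨₃ ⊤₃ = ⊤₃

∼₃ : K3 → K3
∼₃ ⊥₃ = ⊤₃
∼₃ n₃ = n₃
∼₃ ⊤₃ = ⊥₃

D₃ : K3 → Set
D₃ ⊥₃ = ⊥
D₃ n₃ = ⊥
D₃ ⊤₃ = ⊤

K-matrix : Matrix
K-matrix = record { A = K3 ; _∧ᴬ_ = _∧₃_ ; _∨ᴬ_ = _∨₃_ ; ∼ᴬ_ = ∼₃
                  ; ⊤ᴬ = ⊤₃ ; ⊥ᴬ = ⊥₃ ; D = D₃ }

-- The subalgebra {⊥, ⊤} of DM4
data B2 : Set where
  ⊥₂ ⊤₂ : B2

_∧₂_ : B2 → B2 → B2
⊥₂ ∧₂ y = ⊥₂
⊤₂ ∧₂ y = y

_∨₂_ : B2 → B2 → B2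
⊥₂ ∨₂ y = y
⊤₂ ∨₂ y = ⊤₂

∼₂ : B2 → B2
∼₂ ⊥₂ = ⊤₂
∼₂ ⊤₂ = ⊥₂

D₂ : B2 → Set
D₂ ⊥₂ = ⊥
D₂ ⊤₂ = ⊤

CL-matrix : Matrix
CL-matrix = record { A = B2 ; _∧ᴬ_ = _∧₂_ ; _∨ᴬ_ = _∨₂_ ; ∼ᴬ_ = ∼₂
                   ; ⊤ᴬ = ⊤₂ ; ⊥ᴬ = ⊥₂ ; D = D₂ }

BD K CL : RuleSet
BD = Valid BD-matrix
K  = Valid K-matrix
CL = Valid CL-matrix

-- Classical logic assumed at every universe level (the paper's metatheory)
Classical : Setω
Classical = ∀ {ℓ : Level} → ExcludedMiddle ℓ

-- K and CL are structurally complete because every element of their matrices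
-- is named by a formula (⊥ and ⊤ by the constants, n by a variable), so every
-- valuation is recovered from a substitution instance.
--
-- Let L be a non-trivial structurally complete extension of BD. Since L is
-- non-trivial it does not prove ⊥, so every theorem of L is a tautology: a
-- classical refutation of a theorem, substituted by constants, is a
-- BD-contradiction. Every K-theorem is a theorem of L: the K-theorems are the
-- formulas designated in DM4 under the constant valuation n, and formulas are
-- monotone in the knowledge order, at whose bottom n lies. If L proves some φ
-- that is not a K-theorem, then no variable can be n in a DM4-model of the
-- one-variable instances of φ, so such a model lies above a classical valuation
-- and satisfies every tautology; thus L proves all tautologies. Hence L has the
-- theorems of K or of CL, and structurally complete logics are determined by
-- their theorems.

module Submission where

open import Defs
open import Axiom.DoubleNegationElimination using (em⇒dne)
open import Data.Empty using (⊥-elim)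
open import Data.Nat using (ℕ)
open import Data.Product using (Σ; _×_; _,_; proj₁)
open import Data.Product as Product using ()
open import Data.Sum using (_⊎_; inj₁; inj₂)
open import Data.Sum as Sum using ()
open import Function using (_∘_; id)
open import Function.Bundles using (_⇔_; mk⇔; Equivalence)
open import Relation.Nullary using (¬_; yes; no)
open import Relation.Binary.PropositionalEquality
  using (_≡_; _≢_; refl; sym; trans; cong; cong₂; subst)

open Equivalence using (to; from)

module _ {L : RuleSet} (isLogic : IsLogic L) where
  open IsLogic isLogic

  theorem-by-rule : ∀ {Δ ψ} → L Δ ψ → (∀ δ → Δ δ → L ∅ δ) → L ∅ ψ
  theorem-by-rule {Δ} {ψ} Δ⊢ψ ⊢Δ =
    cut ∅ Δ ψ ⊢Δ (monotonicity Δ (∅ ∪ Δ) ψ (λ _ → inj₂) Δ⊢ψ)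

  derivable⇒admissible : ∀ {Γ φ} → L Γ φ → Admissible L Γ φ
  derivable⇒admissible {Γ} {φ} Γ⊢φ σ ⊢σΓ =
    theorem-by-rule (substitution Γ φ σ Γ⊢φ) λ { _ (γ , γ∈Γ , refl) → ⊢σΓ γ γ∈Γ }

  theorem-subst : ∀ {φ} σ → L ∅ φ → L ∅ (φ [ σ ])
  theorem-subst σ ⊢φ = derivable⇒admissible ⊢φ σ λ _ ()

theorem-by-extended-rule : ∀ {L L₀ Δ ψ} → L Extends L₀ →
  L₀ Δ ψ → (∀ δ → Δ δ → L ∅ δ) → L ∅ ψ
theorem-by-extended-rule {Δ = Δ} {ψ} (isLogic , L₀⊆L) Δ⊢ψ =
  theorem-by-rule isLogic (L₀⊆L Δ ψ Δ⊢ψ)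

Admissible-transfer : ∀ {L₁ L₂ Γ φ} → L₁ ∅ ⊆ L₂ ∅ → L₂ ∅ ⊆ L₁ ∅ →
  Admissible L₁ Γ φ → Admissible L₂ Γ φ
Admissible-transfer L₁⊆L₂ L₂⊆L₁ adm σ ⊢σΓ =
  L₁⊆L₂ _ (adm σ λ γ γ∈Γ → L₂⊆L₁ _ (⊢σΓ γ γ∈Γ))

⊆-of-same-theorems : ∀ {L₁ L₂} → IsLogic L₁ → StructurallyComplete L₂ →
  L₁ ∅ ⊆ L₂ ∅ → L₂ ∅ ⊆ L₁ ∅ → ∀ Γ φ → L₁ Γ φ → L₂ Γ φ
⊆-of-same-theorems {L₁} {L₂} isLogic₁ sc₂ L₁⊆L₂ L₂⊆L₁ Γ φ =
  sc₂ Γ φ ∘ Admissible-transfer {L₁} {L₂} {Γ} {φ} L₁⊆L₂ L₂⊆L₁ ∘ derivable⇒admissible isLogic₁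

≐-of-same-theorems : ∀ {L₁ L₂} → IsLogic L₁ → IsLogic L₂ →
  StructurallyComplete L₁ → StructurallyComplete L₂ →
  L₁ ∅ ⊆ L₂ ∅ → L₂ ∅ ⊆ L₁ ∅ → L₁ ≐ L₂
≐-of-same-theorems isLogic₁ isLogic₂ sc₁ sc₂ L₁⊆L₂ L₂⊆L₁ =
  ⊆-of-same-theorems isLogic₁ sc₂ L₁⊆L₂ L₂⊆L₁ ,
  ⊆-of-same-theorems isLogic₂ sc₁ L₂⊆L₁ L₁⊆L₂

module _ (M : Matrix) where
  open Matrix M

  private
    ⟦_⟧ᴹ : Fm → (ℕ → A) → A
    ⟦_⟧ᴹ = ⟦_⟧ M

  ⟦⟧-subst : ∀ φ σ w → ⟦ φ [ σ ] ⟧ᴹ w ≡ ⟦ φ ⟧ᴹ (λ x → ⟦ σ x ⟧ᴹ w)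
  ⟦⟧-subst (var x) σ w = refl
  ⟦⟧-subst (φ ∧ ψ) σ w = cong₂ _∧ᴬ_ (⟦⟧-subst φ σ w) (⟦⟧-subst ψ σ w)
  ⟦⟧-subst (φ ∨ ψ) σ w = cong₂ _∨ᴬ_ (⟦⟧-subst φ σ w) (⟦⟧-subst ψ σ w)
  ⟦⟧-subst (∼ φ) σ w = cong ∼ᴬ_ (⟦⟧-subst φ σ w)
  ⟦⟧-subst top σ w = refl
  ⟦⟧-subst bot σ w = refl

  ⟦⟧-cong : ∀ φ {u v} → (∀ x → u x ≡ v x) → ⟦ φ ⟧ᴹ u ≡ ⟦ φ ⟧ᴹ v
  ⟦⟧-cong (var x) u≡v = u≡v x
  ⟦⟧-cong (φ ∧ ψ) u≡v = cong₂ _∧ᴬ_ (⟦⟧-cong φ u≡v) (⟦⟧-cong ψ u≡v)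
  ⟦⟧-cong (φ ∨ ψ) u≡v = cong₂ _∨ᴬ_ (⟦⟧-cong φ u≡v) (⟦⟧-cong ψ u≡v)
  ⟦⟧-cong (∼ φ) u≡v = cong ∼ᴬ_ (⟦⟧-cong φ u≡v)
  ⟦⟧-cong top u≡v = refl
  ⟦⟧-cong bot u≡v = refl

  Valid-isLogic : IsLogic (Valid M)
  Valid-isLogic = record
    { reflexivity = λ Γ φ φ∈Γ v ⊨Γ → ⊨Γ φ φ∈Γ
    ; monotonicity = λ Γ Δ φ Γ⊆Δ Γ⊨φ v ⊨Δ → Γ⊨φ v λ γ γ∈Γ → ⊨Δ γ (Γ⊆Δ γ γ∈Γ)
    ; cut = λ Γ Δ φ Γ⊨Δ ΓΔ⊨φ v ⊨Γ →
        ΓΔ⊨φ v λ { γ (inj₁ γ∈Γ) → ⊨Γ γ γ∈Γ ; γ (inj₂ γ∈Δ) → Γ⊨Δ γ γ∈Δ v ⊨Γ }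
    ; substitution = λ Γ φ σ Γ⊨φ v ⊨σΓ →
        subst D (sym (⟦⟧-subst φ σ v))
          (Γ⊨φ (λ x → ⟦ σ x ⟧ᴹ v) λ γ γ∈Γ →
            subst D (⟦⟧-subst γ σ v) (⊨σΓ (γ [ σ ]) (γ , γ∈Γ , refl)))
    }

  unsatisfiable⇒Valid : ∀ {Γ} φ → (∀ v → ¬ (∀ γ → Γ γ → D (⟦ γ ⟧ᴹ v))) → Valid M Γ φ
  unsatisfiable⇒Valid φ unsat v ⊨Γ = ⊥-elim (unsat v ⊨Γ)

  DesignationMonotone : (A → A → Set) → Set
  DesignationMonotone _R_ =
    ∀ φ {u v} → (∀ x → u x R v x) → D (⟦ φ ⟧ᴹ u) → D (⟦ φ ⟧ᴹ v)

  -- Substituting the name of v x for each x turns a model v of the premises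
  -- into theorems; evaluating the resulting theorem at w₀ gives back v.
  Valid-structurallyComplete : ∀ {_R_} → DesignationMonotone _R_ →
    (name : A → Fm) (w₀ : ℕ → A) →
    (∀ a w → a R ⟦ name a ⟧ᴹ w) → (∀ a → ⟦ name a ⟧ᴹ w₀ ≡ a) →
    StructurallyComplete (Valid M)
  Valid-structurallyComplete mono name w₀ a≤name name-w₀ Γ φ adm v ⊨Γ =
    subst D (trans (⟦⟧-subst φ σ w₀) (⟦⟧-cong φ λ x → name-w₀ (v x)))
      (adm σ ⊢σΓ w₀ λ _ ())
    where
    σ : Subst
    σ = name ∘ v

    ⊢σΓ : ∀ γ → Γ γ → Valid M ∅ (γ [ σ ])
    ⊢σΓ γ γ∈Γ w _ =
      subst D (sym (⟦⟧-subst γ σ w)) (mono γ (λ x → a≤name (v x) w) (⊨Γ γ γ∈Γ))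

module _ (M N : Matrix) where
  private
    module M = Matrix M
    module N = Matrix N

  record IsStrictHom (h : M.A → N.A) : Set where
    field
      ∧-hom : ∀ a b → h (a M.∧ᴬ b) ≡ h a N.∧ᴬ h b
      ∨-hom : ∀ a b → h (a M.∨ᴬ b) ≡ h a N.∨ᴬ h b
      ∼-hom : ∀ a → h (M.∼ᴬ a) ≡ N.∼ᴬ h a
      ⊤-hom : h M.⊤ᴬ ≡ N.⊤ᴬ
      ⊥-hom : h M.⊥ᴬ ≡ N.⊥ᴬ
      D-preserve : ∀ {a} → M.D a → N.D (h a)
      D-reflect : ∀ {a} → N.D (h a) → M.D a

module IsStrictHomProperties {M N : Matrix} {h} (hom : IsStrictHom M N h) where
  open IsStrictHom hom
  open Matrix N using (D; _∧ᴬ_; _∨ᴬ_; ∼ᴬ_)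

  ⟦⟧-hom : ∀ φ v → ⟦_⟧ N φ (h ∘ v) ≡ h (⟦_⟧ M φ v)
  ⟦⟧-hom (var x) v = refl
  ⟦⟧-hom (φ ∧ ψ) v = trans (cong₂ _∧ᴬ_ (⟦⟧-hom φ v) (⟦⟧-hom ψ v)) (sym (∧-hom _ _))
  ⟦⟧-hom (φ ∨ ψ) v = trans (cong₂ _∨ᴬ_ (⟦⟧-hom φ v) (⟦⟧-hom ψ v)) (sym (∨-hom _ _))
  ⟦⟧-hom (∼ φ) v = trans (cong ∼ᴬ_ (⟦⟧-hom φ v)) (sym (∼-hom _))
  ⟦⟧-hom top v = sym ⊤-hom
  ⟦⟧-hom bot v = sym ⊥-hom

  D-⟦⟧-preserve : ∀ φ v → Matrix.D M (⟦_⟧ M φ v) → D (⟦_⟧ N φ (h ∘ v))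
  D-⟦⟧-preserve φ v = subst D (sym (⟦⟧-hom φ v)) ∘ D-preserve

  D-⟦⟧-reflect : ∀ φ v → D (⟦_⟧ N φ (h ∘ v)) → Matrix.D M (⟦_⟧ M φ v)
  D-⟦⟧-reflect φ v = D-reflect ∘ subst D (⟦⟧-hom φ v)

  Valid⊆ : ∀ Γ φ → Valid N Γ φ → Valid M Γ φ
  Valid⊆ Γ φ Γ⊨φ v ⊨Γ =
    D-⟦⟧-reflect φ v (Γ⊨φ (h ∘ v) λ γ γ∈Γ → D-⟦⟧-preserve γ v (⊨Γ γ γ∈Γ))

  DesignationMonotone-pullback : ∀ {_R_} → DesignationMonotone N _R_ →
    DesignationMonotone M (λ a b → h a R h b)
  DesignationMonotone-pullback mono φ {u} {v} hu≤hv =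
    D-⟦⟧-reflect φ v ∘ mono φ hu≤hv ∘ D-⟦⟧-preserve φ u

-- The knowledge order of a De Morgan matrix with a prime filter

module _ (M : Matrix) where
  open Matrix M

  record IsPrimeDeMorgan : Set where
    field
      ∼-involutive : ∀ a → ∼ᴬ (∼ᴬ a) ≡ a
      ∼-∧ : ∀ a b → ∼ᴬ (a ∧ᴬ b) ≡ (∼ᴬ a) ∨ᴬ (∼ᴬ b)
      ∼-∨ : ∀ a b → ∼ᴬ (a ∨ᴬ b) ≡ (∼ᴬ a) ∧ᴬ (∼ᴬ b)
      D-∧ : ∀ a b → D (a ∧ᴬ b) ⇔ (D a × D b)
      D-∨ : ∀ a b → D (a ∨ᴬ b) ⇔ (D a ⊎ D b)

  -- Belnap's information order; on DM4 it is n ⊑ ⊥, ⊤ ⊑ b.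
  record _⊑_ (a c : A) : Set where
    constructor mk⊑
    field
      truth : D a → D c
      falsity : D (∼ᴬ a) → D (∼ᴬ c)

  ⊑-refl : ∀ {a} → a ⊑ a
  ⊑-refl = mk⊑ id id

module _ {M : Matrix} (isPDM : IsPrimeDeMorgan M) where
  open Matrix M
  open IsPrimeDeMorgan isPDM

  private
    _≤_ : A → A → Set
    _≤_ = _⊑_ M

    D-∼∧ : ∀ a b → D (∼ᴬ (a ∧ᴬ b)) ⇔ (D (∼ᴬ a) ⊎ D (∼ᴬ b))
    D-∼∧ a b = subst (λ c → D c ⇔ _) (sym (∼-∧ a b)) (D-∨ (∼ᴬ a) (∼ᴬ b))

    D-∼∨ : ∀ a b → D (∼ᴬ (a ∨ᴬ b)) ⇔ (D (∼ᴬ a) × D (∼ᴬ b))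
    D-∼∨ a b = subst (λ c → D c ⇔ _) (sym (∼-∨ a b)) (D-∧ (∼ᴬ a) (∼ᴬ b))

    ∧-mono : ∀ {a b c d} → a ≤ c → b ≤ d → (a ∧ᴬ b) ≤ (c ∧ᴬ d)
    ∧-mono {a} {b} {c} {d} (mk⊑ t₁ f₁) (mk⊑ t₂ f₂) = mk⊑
      (from (D-∧ c d) ∘ Product.map t₁ t₂ ∘ to (D-∧ a b))
      (from (D-∼∧ c d) ∘ Sum.map f₁ f₂ ∘ to (D-∼∧ a b))

    ∨-mono : ∀ {a b c d} → a ≤ c → b ≤ d → (a ∨ᴬ b) ≤ (c ∨ᴬ d)
    ∨-mono {a} {b} {c} {d} (mk⊑ t₁ f₁) (mk⊑ t₂ f₂) = mk⊑
      (from (D-∨ c d) ∘ Sum.map t₁ t₂ ∘ to (D-∨ a b))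
      (from (D-∼∨ c d) ∘ Product.map f₁ f₂ ∘ to (D-∼∨ a b))

    ∼-mono : ∀ {a c} → a ≤ c → (∼ᴬ a) ≤ (∼ᴬ c)
    ∼-mono {a} {c} (mk⊑ t f) =
      mk⊑ f (subst D (sym (∼-involutive c)) ∘ t ∘ subst D (∼-involutive a))

  ⟦⟧-⊑-mono : ∀ φ {u v} → (∀ x → u x ≤ v x) → ⟦_⟧ M φ u ≤ ⟦_⟧ M φ v
  ⟦⟧-⊑-mono (var x) u≤v = u≤v x
  ⟦⟧-⊑-mono (φ ∧ ψ) u≤v = ∧-mono (⟦⟧-⊑-mono φ u≤v) (⟦⟧-⊑-mono ψ u≤v)
  ⟦⟧-⊑-mono (φ ∨ ψ) u≤v = ∨-mono (⟦⟧-⊑-mono φ u≤v) (⟦⟧-⊑-mono ψ u≤v)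
  ⟦⟧-⊑-mono (∼ φ) u≤v = ∼-mono (⟦⟧-⊑-mono φ u≤v)
  ⟦⟧-⊑-mono top u≤v = ⊑-refl M
  ⟦⟧-⊑-mono bot u≤v = ⊑-refl M

  ⊑-designationMonotone : DesignationMonotone M _≤_
  ⊑-designationMonotone φ u≤v = _⊑_.truth (⟦⟧-⊑-mono φ u≤v)

⟦_⟧₄ : Fm → (ℕ → DM4) → DM4
⟦_⟧₄ = ⟦_⟧ BD-matrix

⟦_⟧₃ : Fm → (ℕ → K3) → K3
⟦_⟧₃ = ⟦_⟧ K-matrix

⟦_⟧₂ : Fm → (ℕ → B2) → B2
⟦_⟧₂ = ⟦_⟧ CL-matrix

_⊑₄_ : DM4 → DM4 → Set
_⊑₄_ = _⊑_ BD-matrix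

n₄⊑ : ∀ a → n₄ ⊑₄ a
n₄⊑ a = mk⊑ (λ ()) (λ ())

BD-isPrimeDeMorgan : IsPrimeDeMorgan BD-matrix
BD-isPrimeDeMorgan = record
  { ∼-involutive = λ { ⊥₄ → refl ; n₄ → refl ; b₄ → refl ; ⊤₄ → refl }
  ; ∼-∧ = ∼-∧
  ; ∼-∨ = ∼-∨
  ; D-∧ = λ a b → mk⇔ (D-∧⁻ a b) (D-∧⁺ a b)
  ; D-∨ = λ a b → mk⇔ (D-∨⁻ a b) (D-∨⁺ a b)
  }
  where
  ∼-∧ : ∀ a b → ∼₄ (a ∧₄ b) ≡ ∼₄ a ∨₄ ∼₄ b
  ∼-∧ ⊥₄ b = refl
  ∼-∧ ⊤₄ b = refl
  ∼-∧ n₄ ⊥₄ = refl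
  ∼-∧ n₄ n₄ = refl
  ∼-∧ n₄ b₄ = refl
  ∼-∧ n₄ ⊤₄ = refl
  ∼-∧ b₄ ⊥₄ = refl
  ∼-∧ b₄ n₄ = refl
  ∼-∧ b₄ b₄ = refl
  ∼-∧ b₄ ⊤₄ = refl

  ∼-∨ : ∀ a b → ∼₄ (a ∨₄ b) ≡ ∼₄ a ∧₄ ∼₄ b
  ∼-∨ ⊥₄ b = refl
  ∼-∨ ⊤₄ b = refl
  ∼-∨ n₄ ⊥₄ = refl
  ∼-∨ n₄ n₄ = refl
  ∼-∨ n₄ b₄ = refl
  ∼-∨ n₄ ⊤₄ = refl
  ∼-∨ b₄ ⊥₄ = refl
  ∼-∨ b₄ n₄ = refl
  ∼-∨ b₄ b₄ = refl
  ∼-∨ b₄ ⊤₄ = refl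

  D-∧⁻ : ∀ a b → D₄ (a ∧₄ b) → D₄ a × D₄ b
  D-∧⁻ ⊤₄ b d = _ , d
  D-∧⁻ b₄ b₄ d = _
  D-∧⁻ b₄ ⊤₄ d = _
  D-∧⁻ ⊥₄ b ()
  D-∧⁻ n₄ ⊥₄ ()
  D-∧⁻ n₄ n₄ ()
  D-∧⁻ n₄ b₄ ()
  D-∧⁻ n₄ ⊤₄ ()
  D-∧⁻ b₄ ⊥₄ ()
  D-∧⁻ b₄ n₄ ()

  D-∧⁺ : ∀ a b → D₄ a × D₄ b → D₄ (a ∧₄ b)
  D-∧⁺ ⊤₄ b (_ , d) = d
  D-∧⁺ b₄ b₄ _ = _
  D-∧⁺ b₄ ⊤₄ _ = _

  D-∨⁻ : ∀ a b → D₄ (a ∨₄ b) → D₄ a ⊎ D₄ b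
  D-∨⁻ ⊥₄ b d = inj₂ d
  D-∨⁻ b₄ b d = inj₁ _
  D-∨⁻ ⊤₄ b d = inj₁ _
  D-∨⁻ n₄ b₄ d = inj₂ _
  D-∨⁻ n₄ ⊤₄ d = inj₂ _

  D-∨⁺ : ∀ a b → D₄ a ⊎ D₄ b → D₄ (a ∨₄ b)
  D-∨⁺ ⊥₄ b (inj₂ d) = d
  D-∨⁺ b₄ ⊥₄ _ = _
  D-∨⁺ b₄ n₄ _ = _
  D-∨⁺ b₄ b₄ _ = _
  D-∨⁺ b₄ ⊤₄ _ = _
  D-∨⁺ ⊤₄ b _ = _
  D-∨⁺ n₄ b₄ _ = _
  D-∨⁺ n₄ ⊤₄ _ = _
  D-∨⁺ n₄ ⊥₄ (inj₁ ())
  D-∨⁺ n₄ n₄ (inj₁ ())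

ι₃ : K3 → DM4
ι₃ ⊥₃ = ⊥₄
ι₃ n₃ = n₄
ι₃ ⊤₃ = ⊤₄

ι₂ : B2 → DM4
ι₂ ⊥₂ = ⊥₄
ι₂ ⊤₂ = ⊤₄

ι₃-isStrictHom : IsStrictHom K-matrix BD-matrix ι₃
ι₃-isStrictHom = record
  { ∧-hom = ∧-hom
  ; ∨-hom = ∨-hom
  ; ∼-hom = λ { ⊥₃ → refl ; n₃ → refl ; ⊤₃ → refl }
  ; ⊤-hom = refl
  ; ⊥-hom = refl
  ; D-preserve = λ { {⊤₃} _ → _ }
  ; D-reflect = λ { {⊤₃} _ → _ }
  }
  where
  ∧-hom : ∀ a b → ι₃ (a ∧₃ b) ≡ ι₃ a ∧₄ ι₃ b
  ∧-hom ⊥₃ b = refl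
  ∧-hom ⊤₃ b = refl
  ∧-hom n₃ ⊥₃ = refl
  ∧-hom n₃ n₃ = refl
  ∧-hom n₃ ⊤₃ = refl

  ∨-hom : ∀ a b → ι₃ (a ∨₃ b) ≡ ι₃ a ∨₄ ι₃ b
  ∨-hom ⊥₃ b = refl
  ∨-hom ⊤₃ b = refl
  ∨-hom n₃ ⊥₃ = refl
  ∨-hom n₃ n₃ = refl
  ∨-hom n₃ ⊤₃ = refl

ι₂-isStrictHom : IsStrictHom CL-matrix BD-matrix ι₂
ι₂-isStrictHom = record
  { ∧-hom = λ { ⊥₂ b → refl ; ⊤₂ b → refl }
  ; ∨-hom = λ { ⊥₂ b → refl ; ⊤₂ b → refl }
  ; ∼-hom = λ { ⊥₂ → refl ; ⊤₂ → refl }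
  ; ⊤-hom = refl
  ; ⊥-hom = refl
  ; D-preserve = λ { {⊤₂} _ → _ }
  ; D-reflect = λ { {⊤₂} _ → _ }
  }

module ι₃ = IsStrictHomProperties ι₃-isStrictHom
module ι₂ = IsStrictHomProperties ι₂-isStrictHom

K-extends-BD : K Extends BD
K-extends-BD = Valid-isLogic K-matrix , ι₃.Valid⊆

CL-extends-BD : CL Extends BD
CL-extends-BD = Valid-isLogic CL-matrix , ι₂.Valid⊆

K-nonTrivial : NonTrivial K
K-nonTrivial trivial = trivial ∅ bot (λ _ → ⊤₃) λ _ ()

CL-nonTrivial : NonTrivial CL
CL-nonTrivial trivial = trivial ∅ bot (λ _ → ⊤₂) λ _ ()

_⊑₃_ : K3 → K3 → Set
a ⊑₃ c = ι₃ a ⊑₄ ι₃ c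

K-structurallyComplete : StructurallyComplete K
K-structurallyComplete =
  Valid-structurallyComplete K-matrix {_⊑₃_}
    (ι₃.DesignationMonotone-pullback {_⊑₄_} (⊑-designationMonotone BD-isPrimeDeMorgan))
    name (λ _ → n₃) name-⊒ name-at-n
  where
  name : K3 → Fm
  name ⊥₃ = bot
  name n₃ = var 0
  name ⊤₃ = top

  name-⊒ : ∀ a w → a ⊑₃ ⟦ name a ⟧₃ w
  name-⊒ ⊥₃ w = ⊑-refl BD-matrix
  name-⊒ n₃ w = n₄⊑ _
  name-⊒ ⊤₃ w = ⊑-refl BD-matrix

  name-at-n : ∀ a → ⟦ name a ⟧₃ (λ _ → n₃) ≡ a
  name-at-n ⊥₃ = refl
  name-at-n n₃ = refl
  name-at-n ⊤₃ = refl

constant : B2 → Fm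
constant ⊥₂ = bot
constant ⊤₂ = top

⟦constant⟧₄ : ∀ a w → ⟦ constant a ⟧₄ w ≡ ι₂ a
⟦constant⟧₄ ⊥₂ w = refl
⟦constant⟧₄ ⊤₂ w = refl

CL-structurallyComplete : StructurallyComplete CL
CL-structurallyComplete =
  Valid-structurallyComplete CL-matrix {_≡_} ≡-designationMonotone
    constant (λ _ → ⊥₂) ⟦constant⟧₂ (λ a → sym (⟦constant⟧₂ a _))
  where
  ≡-designationMonotone : DesignationMonotone CL-matrix _≡_
  ≡-designationMonotone φ u≡v = subst D₂ (⟦⟧-cong CL-matrix φ u≡v)

  ⟦constant⟧₂ : ∀ a w → a ≡ ⟦ constant a ⟧₂ w
  ⟦constant⟧₂ ⊥₂ w = refl
  ⟦constant⟧₂ ⊤₂ w = refl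

designated-at-n⇒BD-theorem : ∀ φ → D₄ (⟦ φ ⟧₄ (λ _ → n₄)) → BD ∅ φ
designated-at-n⇒BD-theorem φ d w _ =
  ⊑-designationMonotone BD-isPrimeDeMorgan φ (λ x → n₄⊑ (w x)) d

K-theorem⇒BD-theorem : ∀ φ → K ∅ φ → BD ∅ φ
K-theorem⇒BD-theorem φ ⊨φ =
  designated-at-n⇒BD-theorem φ (ι₃.D-⟦⟧-preserve φ _ (⊨φ (λ _ → n₃) λ _ ()))

BD-explosion : ∀ φ → BD (λ χ → χ ≡ bot) φ
BD-explosion φ = unsatisfiable⇒Valid BD-matrix φ λ v ⊨bot → ⊨bot bot refl

⟦⟧-constant-instance : ∀ φ v w → ⟦ φ [ constant ∘ v ] ⟧₄ w ≡ ι₂ (⟦ φ ⟧₂ v)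
⟦⟧-constant-instance φ v w =
  trans (⟦⟧-subst BD-matrix φ _ w)
    (trans (⟦⟧-cong BD-matrix φ λ x → ⟦constant⟧₄ (v x) w) (ι₂.⟦⟧-hom φ v))

classical-refutation⇒BD-explosion : ∀ φ v → ⟦ φ ⟧₂ v ≡ ⊥₂ →
  ∀ ψ → BD (λ χ → χ ≡ φ [ constant ∘ v ]) ψ
classical-refutation⇒BD-explosion φ v refuted ψ =
  unsatisfiable⇒Valid BD-matrix ψ λ w ⊨φσ →
    subst D₄ (trans (⟦⟧-constant-instance φ v w) (cong ι₂ refuted))
      (⊨φσ _ refl)

-- n₄ lies above no classical value; it is sent to ⊤₂ arbitrarily.
classicalApprox : DM4 → B2
classicalApprox ⊥₄ = ⊥₂
classicalApprox n₄ = ⊤₂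
classicalApprox b₄ = ⊤₂
classicalApprox ⊤₄ = ⊤₂

classicalApprox-⊑ : ∀ a → a ≢ n₄ → ι₂ (classicalApprox a) ⊑₄ a
classicalApprox-⊑ ⊥₄ _ = ⊑-refl BD-matrix
classicalApprox-⊑ n₄ a≢n = ⊥-elim (a≢n refl)
classicalApprox-⊑ b₄ _ = mk⊑ _ λ ()
classicalApprox-⊑ ⊤₄ _ = ⊑-refl BD-matrix

_⟨_⟩ : Fm → ℕ → Fm
φ ⟨ y ⟩ = φ [ (λ _ → var y) ]

OneVariableInstances : Fm → FmSet
OneVariableInstances φ ψ = Σ ℕ λ y → ψ ≡ φ ⟨ y ⟩

non-K-theorem⇒tautologies : ∀ φ → ¬ K ∅ φ →
  ∀ χ → CL ∅ χ → BD (OneVariableInstances φ) χ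
non-K-theorem⇒tautologies φ ⊭φ χ ⊨χ w ⊨φ⟨⟩ =
  ⊑-designationMonotone BD-isPrimeDeMorgan χ
    (λ y → classicalApprox-⊑ (w y) (w≢n y))
    (ι₂.D-⟦⟧-preserve χ _ (⊨χ _ λ _ ()))
  where
  w≢n : ∀ y → w y ≢ n₄
  w≢n y wy≡n = ⊭φ (ι₃.Valid⊆ ∅ φ (designated-at-n⇒BD-theorem φ
    (subst (λ a → D₄ (⟦ φ ⟧₄ (λ _ → a))) wy≡n
      (subst D₄ (⟦⟧-subst BD-matrix φ _ w) (⊨φ⟨⟩ _ (y , refl))))))

-- Structurally complete extensions of BD

module ExtensionOfBD (L : RuleSet) (ext : L Extends BD)
                     (nonTrivial : NonTrivial L) (sc : StructurallyComplete L) where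

  private
    isLogic : IsLogic L
    isLogic = proj₁ ext

    theorem-by-BD-rule : ∀ {Δ ψ} → BD Δ ψ → (∀ δ → Δ δ → L ∅ δ) → L ∅ ψ
    theorem-by-BD-rule = theorem-by-extended-rule ext

  bot-unprovable : ¬ L ∅ bot
  bot-unprovable ⊢bot = nonTrivial λ Γ φ → sc Γ φ λ σ _ →
    theorem-by-BD-rule (BD-explosion (φ [ σ ])) λ { _ refl → ⊢bot }

  theorems⊆CL : L ∅ ⊆ CL ∅
  theorems⊆CL φ ⊢φ v _ with ⟦ φ ⟧₂ v in eq
  ... | ⊤₂ = _
  ... | ⊥₂ = ⊥-elim (bot-unprovable
    (theorem-by-BD-rule (classical-refutation⇒BD-explosion φ v eq bot)
      λ { _ refl → theorem-subst isLogic (constant ∘ v) ⊢φ }))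

  K⊆theorems : K ∅ ⊆ L ∅
  K⊆theorems φ ⊨φ = theorem-by-BD-rule (K-theorem⇒BD-theorem φ ⊨φ) λ _ ()

  CL⊆theorems : ∀ {φ} → L ∅ φ → ¬ K ∅ φ → CL ∅ ⊆ L ∅
  CL⊆theorems {φ} ⊢φ ⊭φ χ ⊨χ =
    theorem-by-BD-rule (non-K-theorem⇒tautologies φ ⊭φ χ ⊨χ)
      λ { _ (y , refl) → theorem-subst isLogic _ ⊢φ }

  classification : Classical → (L ≐ K) ⊎ (L ≐ CL)
  classification em with em {P = Σ Fm λ φ → L ∅ φ × ¬ K ∅ φ}
  ... | yes (φ , ⊢φ , ⊭φ) =
    inj₂ (≐-of-same-theorems isLogic (Valid-isLogic CL-matrix) sc
            CL-structurallyComplete theorems⊆CL (CL⊆theorems ⊢φ ⊭φ))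
  ... | no ∄φ =
    inj₁ (≐-of-same-theorems isLogic (Valid-isLogic K-matrix) sc
            K-structurallyComplete
            (λ φ ⊢φ → em⇒dne em λ ⊭φ → ∄φ (φ , ⊢φ , ⊭φ)) K⊆theorems)

proposition6p21 : Classical →
    (K Extends BD × NonTrivial K × StructurallyComplete K) ×
    (CL Extends BD × NonTrivial CL × StructurallyComplete CL) ×
    (∀ (L : RuleSet) → L Extends BD → NonTrivial L → StructurallyComplete L →
      (L ≐ K) ⊎ (L ≐ CL))
proposition6p21 em =
  (K-extends-BD , K-nonTrivial , K-structurallyComplete) ,
  (CL-extends-BD , CL-nonTrivial , CL-structurallyComplete) ,
  λ L ext nonTrivial sc → ExtensionOfBD.classification L ext nonTrivial sc em
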